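{- There exists a cyclic $(47;22,14;14)$ difference family, i.e. there exist subsets $X_1,X_2\subseteq \mathbb{Z}_{47}$ with $|X_1|=22$, $|X_2|=14$ such that for every nonzero $a\in\mathbb{Z}_{47}$, $$\#\{(x,y)\in X_1\times X_1: y-x=a\}+\#\{(x,y)\in X_2\times X_2: y-x=a\}=14.$$
   Context: $\mathbb{Z}_v$ denotes the cyclic group (ring) of integers modulo $v$. A cyclic $(v;r,s;\lambda)$ difference family is a pair $(X_1,X_2)$ of subsets of $\mathbb{Z}_v$ with $|X_1|=r$, $|X_2|=s$ such that for every nonzero $a\in\mathbb{Z}_v$ the total number of ordered pairs $(x,y)$ with $x,y$ in the same block $X_i$ and $y-x=a$ equals $\lambda$. -}

module Defs where

open import Data.Nat using (ℕ; suc; _+_; _∸_; _%_; NonZero)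
open import Data.Fin using (Fin; toℕ; fromℕ<)
open import Data.Fin.Subset using (Subset; _∈_; ∣_∣)
open import Data.Fin.Subset.Properties using (_∈?_)
open import Data.List using (List; length; filter; cartesianProduct; allFin)
open import Data.Product using (_×_; _,_; proj₁; proj₂)
open import Data.Nat.DivMod using (m%n<n)
open import Relation.Nullary using (¬_)
open import Relation.Nullary.Decidable using (_×-dec_)
open import Relation.Binary.PropositionalEquality using (_≡_)
import Data.Fin.Properties as FinP

_⊖_ : {v : ℕ} .{{_ : NonZero v}} → Fin v → Fin v → Fin v
_⊖_ {v} y x = fromℕ< (m%n<n (toℕ y + (v ∸ toℕ x)) v)

allPairs : (v : ℕ) → List (Fin v × Fin v)
allPairs v = cartesianProduct (allFin v) (allFin v)

pairCount : {v : ℕ} .{{_ : NonZero v}} → Subset v → Fin v → ℕ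
pairCount {v} X a =
  length (filter (λ p → (proj₁ p ∈? X) ×-dec ((proj₂ p ∈? X) ×-dec (proj₂ p ⊖ proj₁ p FinP.≟ a)))
                 (allPairs v))

IsCyclicDF : (v r s lam : ℕ) .{{_ : NonZero v}} → Subset v → Subset v → Set
IsCyclicDF v r s lam X₁ X₂ =
  (∣ X₁ ∣ ≡ r) × (∣ X₂ ∣ ≡ s) ×
  ((a : Fin v) → ¬ (toℕ a ≡ 0) → pairCount X₁ a + pairCount X₂ a ≡ lam)

module Submission where

open import Defs
open import Data.Fin using (Fin; toℕ; #_)
open import Data.Fin.Properties using (all?)
open import Data.Fin.Subset using (Subset; ⋃; ⁅_⁆)
open import Data.List using (List; []; _∷_; map)
open import Data.Nat using (ℕ; NonZero; _+_; _≟_)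
open import Data.Product using (∃₂; _,_)
open import Relation.Binary.PropositionalEquality using (_≡_; refl)
open import Relation.Nullary using (Dec; ¬_; ¬?)
open import Relation.Nullary.Decidable using (toWitness; _→-dec_)

DifferenceCondition : (v lam : ℕ) .{{_ : NonZero v}} → Subset v → Subset v → Set
DifferenceCondition v lam X₁ X₂ =
  (a : Fin v) → ¬ (toℕ a ≡ 0) → pairCount X₁ a + pairCount X₂ a ≡ lam

differenceCondition? : (v lam : ℕ) .{{_ : NonZero v}} (X₁ X₂ : Subset v) →
                       Dec (DifferenceCondition v lam X₁ X₂)
differenceCondition? v lam X₁ X₂ =
  all? λ a → ¬? (toℕ a ≟ 0) →-dec (pairCount X₁ a + pairCount X₂ a ≟ lam)

fromElements : {v : ℕ} → List (Fin v) → Subset v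
fromElements xs = ⋃ (map ⁅_⁆ xs)

-- Blocks found by computer search; every difference count is then checked by evaluation.
block₁ : Subset 47
block₁ = fromElements
  ( # 1 ∷ # 2 ∷ # 3 ∷ # 7 ∷ # 9 ∷ # 13 ∷ # 14 ∷ # 15 ∷ # 17 ∷ # 18 ∷ # 26
  ∷ # 28 ∷ # 33 ∷ # 35 ∷ # 36 ∷ # 37 ∷ # 39 ∷ # 40 ∷ # 42 ∷ # 44 ∷ # 45 ∷ # 46 ∷ [])

block₂ : Subset 47
block₂ = fromElements
  ( # 2 ∷ # 5 ∷ # 10 ∷ # 11 ∷ # 12 ∷ # 15 ∷ # 22
  ∷ # 28 ∷ # 29 ∷ # 31 ∷ # 34 ∷ # 37 ∷ # 44 ∷ # 45 ∷ [])

mainTheorem5 : ∃₂ λ (X₁ X₂ : Subset 47) → IsCyclicDF 47 22 14 14 X₁ X₂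
mainTheorem5 =
  block₁ , block₂ , refl , refl ,
  toWitness {a? = differenceCondition? 47 14 block₁ block₂} _
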